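{- Let $G$ be a graph with minimum degree $\delta$, and let $S$ and $B$ be induced subgraphs of $G$ with $V(B)=N_G[V(S)]$. Suppose $\max_{u,v\in V(S)}d_B(u,v)\ge4$ and there exist $a,e\in V(S)$ with $d_B(a,e)=d_S(a,e)=4$. Then one of the following holds: (1) there exist $u,v\in V(S)$ with $d_B(u,v)=2$ and $|N_B[u]\cup N_B[v]|\ge\frac{28}{15}(\delta+1)$; (2) there are vertices $b,c,d$ such that $a,b,c,d,e$ is a path in $S$ and $|N[a]\cup N[e]\cup(N[b]\cap N[d])|\ge\frac{32}{15}(\delta+1)$.
   Context: $d_H(x,y)$ is the distance in the graph $H$. $N_H[x]$ is the closed neighborhood of $x$ in $H$; $N[x]$ means $N_G[x]$; for a vertex set $X$, $N_G[X]$ is the set of vertices at distance at most $1$ from $X$ in $G$. -}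

module Defs where

open import Data.Nat using (ℕ; zero; suc; _≤_; _<_; _*_; _+_)
open import Data.Bool using (Bool; true; false; _∨_)
open import Data.Fin using (Fin; _≟_)
open import Data.Fin.Subset using (Subset; _∈_; _∪_; _∩_; ∣_∣)
open import Data.Vec using (tabulate)
open import Data.Product using (Σ; _×_; ∃; _,_)
open import Relation.Nullary using (¬_; does)
open import Relation.Binary.PropositionalEquality using (_≡_; _≢_)

record Graph (n : ℕ) : Set where
  field
    adj   : Fin n → Fin n → Bool
    sym   : ∀ u v → adj u v ≡ adj v u
    irrefl : ∀ v → adj v v ≡ false
open Graph public

module _ {n : ℕ} (G : Graph n) where

  Adj : Fin n → Fin n → Set
  Adj u v = adj G u v ≡ true

  nbhd : Fin n → Subset n
  nbhd v = tabulate (λ w → adj G v w)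

  cnbhd : Fin n → Subset n
  cnbhd v = tabulate (λ w → does (v ≟ w) ∨ adj G v w)

  degree : Fin n → ℕ
  degree v = ∣ nbhd v ∣

  IsMinDegree : ℕ → Set
  IsMinDegree δ = (∀ v → δ ≤ degree v) × (∃ λ v → degree v ≡ δ)

  data Walk (X : Subset n) : Fin n → Fin n → ℕ → Set where
    here : ∀ {x} → x ∈ X → Walk X x x zero
    step : ∀ {x y z k} → x ∈ X → Adj x y → Walk X y z k → Walk X x z (suc k)

  Dist : Subset n → Fin n → Fin n → ℕ → Set
  Dist X x y k = Walk X x y k × (∀ m → m < k → ¬ Walk X x y m)

  -- d_{G[X]}(x , y) ≥ k (including the case of infinite distance)
  DistGE : Subset n → Fin n → Fin n → ℕ → Set
  DistGE X x y k = ∀ m → m < k → ¬ Walk X x y m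

  cnbhdIn : Subset n → Fin n → Subset n
  cnbhdIn X v = cnbhd v ∩ X

  IsClosedNbhdOf : Subset n → Subset n → Set
  IsClosedNbhdOf X' X =
    ∀ w → (w ∈ X' → ∃ λ v → v ∈ X × w ∈ cnbhd v)
        × ((∃ λ v → v ∈ X × w ∈ cnbhd v) → w ∈ X')

  IsPath5 : Subset n → Fin n → Fin n → Fin n → Fin n → Fin n → Set
  IsPath5 X a b c d e =
    (a ∈ X × b ∈ X × c ∈ X × d ∈ X × e ∈ X)
    × (Adj a b × Adj b c × Adj c d × Adj d e)
    × (a ≢ b × a ≢ c × a ≢ d × a ≢ e × b ≢ c × b ≢ d × b ≢ e
       × c ≢ d × c ≢ e × d ≢ e)

module Submission where

-- Proof idea.  The S-geodesic from a to e is a path a , b , c , d , e in S, and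
-- this path already witnesses (1) with u = b, v = d, or (2).
--
-- Since d_B(a,e) ≥ 4, the triangle inequality (far-inner) shows
--    d_B(b,d) = 2, that the five path vertices are distinct, and that the sets
--    N[a], N[e] and N[b] ∩ N[d] are pairwise disjoint (each of them lies in
--    B = N[S], so a common vertex would give an a–e walk of length ≤ 3).
--  * Counting.  Write D = δ + 1.  Every closed neighbourhood has ≥ D vertices,
--    and for v ∈ S we have N_B[v] = N[v].  Inclusion–exclusion gives
--    U + I ≥ 2D for U = |N_B[b] ∪ N_B[d]|, I = |N_B[b] ∩ N_B[d]|, and
--    disjointness gives |N[a] ∪ N[e] ∪ (N[b] ∩ N[d])| ≥ 2D + I.
--  * If 15U ≥ 28D we are in case (1); otherwise I > 2D/15, and the
--    arithmetic lemma (counting-bound) yields case (2).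

open import Defs
open import Data.Nat using (ℕ; suc; _+_; _*_; _≤_; _<_; z≤n; s≤s; _≤?_)
open import Data.Nat.Properties
  using (+-comm; +-suc; +-identityʳ; ≤-refl; ≤-trans; <⇒≤; ≰⇒>;
         +-mono-≤; +-monoˡ-≤; +-monoʳ-≤; +-monoʳ-<; +-mono-≤-<; +-mono-<-≤;
         *-monoʳ-≤; +-cancelʳ-≤; module ≤-Reasoning)
open import Data.Nat.Tactic.RingSolver using (solve-∀)
open import Data.Bool using (Bool; true; _∨_)
open import Data.Bool.Properties using (∨-zeroʳ)
open import Data.Fin using (Fin; _≟_)
open import Data.Fin.Subset
  using (Subset; _∈_; _∪_; _∩_; _⊆_; _-_; ∣_∣; inside; outside)
open import Data.Fin.Subset.Properties
  using (x∈p∩q⁻; x∈p∩q⁺; x∈p∪q⁻; p⊆q⇒∣p∣≤∣q∣; ∣⊥∣≡0; Empty-unique;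
         x∈p∧x≢y⇒x∈p-y; x∈p⇒∣p-x∣<∣p∣)
open import Data.Vec using ([]; _∷_; tabulate)
open import Data.Vec.Properties using ([]=⇒lookup; lookup⇒[]=; lookup∘tabulate)
open import Data.Empty using (⊥)
open import Data.Product using (_×_; ∃-syntax; _,_; proj₁; proj₂)
open import Data.Sum using (_⊎_; inj₁; inj₂)
open import Relation.Nullary using (does; yes; no)
open import Relation.Nullary.Decidable using (dec-true)
open import Relation.Binary.PropositionalEquality
  using (_≡_; _≢_; refl; trans; cong; subst; module ≡-Reasoning)
  renaming (sym to ≡-sym)

∈-tabulate⁻ : ∀ {n} (f : Fin n → Bool) {x} → x ∈ tabulate f → f x ≡ true
∈-tabulate⁻ f {x} x∈ = trans (≡-sym (lookup∘tabulate f x)) ([]=⇒lookup x∈)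

∈-tabulate⁺ : ∀ {n} (f : Fin n → Bool) {x} → f x ≡ true → x ∈ tabulate f
∈-tabulate⁺ f {x} fx = lookup⇒[]= x (tabulate f) (trans (lookup∘tabulate f x) fx)

∣p∪q∣+∣p∩q∣≡∣p∣+∣q∣ : ∀ {n} (p q : Subset n) → ∣ p ∪ q ∣ + ∣ p ∩ q ∣ ≡ ∣ p ∣ + ∣ q ∣
∣p∪q∣+∣p∩q∣≡∣p∣+∣q∣ [] [] = refl
∣p∪q∣+∣p∩q∣≡∣p∣+∣q∣ (inside ∷ p) (inside ∷ q) =
  cong suc (trans (+-suc _ _) (trans (cong suc (∣p∪q∣+∣p∩q∣≡∣p∣+∣q∣ p q)) (≡-sym (+-suc _ _))))
∣p∪q∣+∣p∩q∣≡∣p∣+∣q∣ (inside ∷ p) (outside ∷ q) = cong suc (∣p∪q∣+∣p∩q∣≡∣p∣+∣q∣ p q)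
∣p∪q∣+∣p∩q∣≡∣p∣+∣q∣ (outside ∷ p) (inside ∷ q) =
  trans (cong suc (∣p∪q∣+∣p∩q∣≡∣p∣+∣q∣ p q)) (≡-sym (+-suc _ _))
∣p∪q∣+∣p∩q∣≡∣p∣+∣q∣ (outside ∷ p) (outside ∷ q) = ∣p∪q∣+∣p∩q∣≡∣p∣+∣q∣ p q

Disjoint : ∀ {n} → Subset n → Subset n → Set
Disjoint p q = ∀ {x} → x ∈ p → x ∈ q → ⊥

∣p∪q∣-disjoint : ∀ {n} (p q : Subset n) → Disjoint p q → ∣ p ∪ q ∣ ≡ ∣ p ∣ + ∣ q ∣
∣p∪q∣-disjoint {n} p q disj = begin
  ∣ p ∪ q ∣              ≡⟨ ≡-sym (+-identityʳ _) ⟩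
  ∣ p ∪ q ∣ + 0          ≡⟨ cong (∣ p ∪ q ∣ +_) (≡-sym ∣p∩q∣≡0) ⟩
  ∣ p ∪ q ∣ + ∣ p ∩ q ∣  ≡⟨ ∣p∪q∣+∣p∩q∣≡∣p∣+∣q∣ p q ⟩
  ∣ p ∣ + ∣ q ∣          ∎
  where
  open ≡-Reasoning
  ∣p∩q∣≡0 : ∣ p ∩ q ∣ ≡ 0
  ∣p∩q∣≡0 = trans (cong ∣_∣ (Empty-unique λ (x , x∈p∩q) → let (x∈p , x∈q) = x∈p∩q⁻ p q x∈p∩q in disj x∈p x∈q))
                  (∣⊥∣≡0 n)

-- The arithmetic core: if 15U < 28D, U + I ≥ 2D and X ≥ 2D + I, then
-- 15X ≥ 30D + 15I ≥ 60D − 15U > 32D.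
counting-bound : ∀ D U I X → 15 * U < 28 * D → 2 * D ≤ U + I → 2 * D + I ≤ X
               → 32 * D ≤ 15 * X
counting-bound D U I X 15U<28D 2D≤U+I 2D+I≤X =
  +-cancelʳ-≤ (15 * U) (32 * D) (15 * X) (<⇒≤ chain)
  where
  open ≤-Reasoning
  regroup₁ : ∀ D → 32 * D + 28 * D ≡ 30 * D + 15 * (2 * D)
  regroup₁ = solve-∀
  regroup₂ : ∀ D U I → 30 * D + 15 * (U + I) ≡ 15 * (2 * D + I) + 15 * U
  regroup₂ = solve-∀
  chain : 32 * D + 15 * U < 15 * X + 15 * U
  chain = begin-strict
    32 * D + 15 * U            <⟨ +-monoʳ-< (32 * D) 15U<28D ⟩
    32 * D + 28 * D            ≡⟨ regroup₁ D ⟩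
    30 * D + 15 * (2 * D)      ≤⟨ +-monoʳ-≤ (30 * D) (*-monoʳ-≤ 15 2D≤U+I) ⟩
    30 * D + 15 * (U + I)      ≡⟨ regroup₂ D U I ⟩
    15 * (2 * D + I) + 15 * U  ≤⟨ +-monoˡ-≤ (15 * U) (*-monoʳ-≤ 15 2D+I≤X) ⟩
    15 * X + 15 * U            ∎

module GraphFacts {n : ℕ} (G : Graph n) where

  ∈cnbhd⁻ : ∀ {x y} → y ∈ cnbhd G x → x ≡ y ⊎ Adj G x y
  ∈cnbhd⁻ {x} {y} y∈ with x ≟ y | ∈-tabulate⁻ (λ w → does (x ≟ w) ∨ adj G x w) y∈
  ... | yes x≡y | _  = inj₁ x≡y
  ... | no _    | xy = inj₂ xy

  x∈cnbhd-x : ∀ x → x ∈ cnbhd G x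
  x∈cnbhd-x x = ∈-tabulate⁺ _ (cong (_∨ adj G x x) (dec-true (x ≟ x) refl))

  adj⇒∈cnbhd : ∀ {x y} → Adj G x y → y ∈ cnbhd G x
  adj⇒∈cnbhd {x} {y} xy = ∈-tabulate⁺ _ (trans (cong (does (x ≟ y) ∨_) xy) (∨-zeroʳ _))

  cnbhd-sym : ∀ {x y} → y ∈ cnbhd G x → x ∈ cnbhd G y
  cnbhd-sym {x} y∈ with ∈cnbhd⁻ y∈
  ... | inj₁ refl = x∈cnbhd-x x
  ... | inj₂ xy   = adj⇒∈cnbhd (trans (sym G _ x) xy)

  degree<∣cnbhd∣ : ∀ v → degree G v < ∣ cnbhd G v ∣
  degree<∣cnbhd∣ v = ≤-trans (s≤s (p⊆q⇒∣p∣≤∣q∣ N⊆N[v]-v)) (x∈p⇒∣p-x∣<∣p∣ (x∈cnbhd-x v))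
    where
    N⊆N[v]-v : nbhd G v ⊆ cnbhd G v - v
    N⊆N[v]-v {w} w∈ = x∈p∧x≢y⇒x∈p-y (adj⇒∈cnbhd vw) w≢v
      where
      vw : Adj G v w
      vw = ∈-tabulate⁻ (adj G v) w∈
      w≢v : w ≢ v
      w≢v refl with trans (≡-sym vw) (irrefl G v)
      ... | ()

  cnbhd-lower : ∀ {δ} v → δ ≤ degree G v → δ + 1 ≤ ∣ cnbhd G v ∣
  cnbhd-lower {δ} v δ≤deg =
    subst (_≤ ∣ cnbhd G v ∣) (+-comm 1 δ) (≤-trans (s≤s δ≤deg) (degree<∣cnbhd∣ v))

  ⊆closure : ∀ {X Y} → IsClosedNbhdOf G Y X → X ⊆ Y
  ⊆closure cl {v} v∈X = proj₂ (cl v) (v , v∈X , x∈cnbhd-x v)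

  cnbhd⊆closure : ∀ {X Y v} → IsClosedNbhdOf G Y X → v ∈ X → cnbhd G v ⊆ Y
  cnbhd⊆closure cl v∈X {w} w∈ = proj₂ (cl w) (_ , v∈X , w∈)

  walk-target : ∀ {X x y k} → Walk G X x y k → y ∈ X
  walk-target (here y∈X)  = y∈X
  walk-target (step _ _ w) = walk-target w

  infixl 5 _++ʷ_ _++ˡ_
  _++ʷ_ : ∀ {X x y z j k} → Walk G X x y j → Walk G X y z k → Walk G X x z (j + k)
  here _       ++ʷ w′ = w′
  step x∈ xy w ++ʷ w′ = step x∈ xy (w ++ʷ w′)

  WalkLE : Subset n → Fin n → Fin n → ℕ → Set
  WalkLE X x y k = ∃[ m ] m ≤ k × Walk G X x y m

  _++ˡ_ : ∀ {X x y z j k} → WalkLE X x y j → WalkLE X y z k → WalkLE X x z (j + k)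
  (m , m≤j , w) ++ˡ (m′ , m′≤k , w′) = m + m′ , +-mono-≤ m≤j m′≤k , w ++ʷ w′

  cnbhd-walk : ∀ {X x y} → x ∈ X → y ∈ X → y ∈ cnbhd G x → WalkLE X x y 1
  cnbhd-walk x∈X y∈X y∈ with ∈cnbhd⁻ y∈
  ... | inj₁ refl = 0 , z≤n , here x∈X
  ... | inj₂ xy   = 1 , ≤-refl , step x∈X xy (here y∈X)

  far-inner : ∀ {X a e x y i j} k → DistGE G X a e (i + k + j)
            → WalkLE X a x i → WalkLE X y e j → DistGE G X x y k
  far-inner k far (p , p≤i , a⇝x) (q , q≤j , y⇝e) m m<k x⇝y =
    far (p + m + q) (+-mono-<-≤ (+-mono-≤-< p≤i m<k) q≤j) (a⇝x ++ʷ x⇝y ++ʷ y⇝e)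

  far⇒≢ : ∀ {X a e x y i j} k → DistGE G X a e (i + suc k + j)
        → WalkLE X a x i → WalkLE X y e j → x ≢ y
  far⇒≢ k far a⇝x@(_ , _ , w) y⇝e refl =
    far-inner (suc k) far a⇝x y⇝e 0 (s≤s z≤n) (here (walk-target w))

Conclusion : ∀ {n} (G : Graph n) (δ : ℕ) (VS VB : Subset n) (a e : Fin n) → Set
Conclusion G δ VS VB a e =
  (∃[ u ] ∃[ v ] (u ∈ VS × v ∈ VS × Dist G VB u v 2
     × 28 * (δ + 1) ≤ 15 * ∣ cnbhdIn G VB u ∪ cnbhdIn G VB v ∣))
  ⊎ (∃[ b ] ∃[ c ] ∃[ d ] (IsPath5 G VS a b c d e
     × 32 * (δ + 1) ≤ 15 * ∣ cnbhd G a ∪ cnbhd G e ∪ (cnbhd G b ∩ cnbhd G d) ∣))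

module Geodesic {n} (G : Graph n) {VS VB : Subset n} (closure : IsClosedNbhdOf G VB VS)
  {a b c d e : Fin n} (a∈S : a ∈ VS) (b∈S : b ∈ VS) (c∈S : c ∈ VS) (d∈S : d ∈ VS) (e∈S : e ∈ VS)
  (ab : Adj G a b) (bc : Adj G b c) (cd : Adj G c d) (de : Adj G d e)
  (far : DistGE G VB a e 4) where

  open GraphFacts G

  S⊆B : VS ⊆ VB
  S⊆B = ⊆closure closure

  edge : ∀ {x y} → x ∈ VS → y ∈ VS → Adj G x y → WalkLE VB x y 1
  edge x∈S y∈S xy = cnbhd-walk (S⊆B x∈S) (S⊆B y∈S) (adj⇒∈cnbhd xy)

  stay : ∀ {x} → x ∈ VS → WalkLE VB x x 0
  stay x∈S = 0 , z≤n , here (S⊆B x∈S)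

  a⇝a : WalkLE VB a a 0
  a⇝a = stay a∈S
  a⇝b : WalkLE VB a b 1
  a⇝b = edge a∈S b∈S ab
  a⇝c : WalkLE VB a c 2
  a⇝c = a⇝b ++ˡ edge b∈S c∈S bc
  a⇝d : WalkLE VB a d 3
  a⇝d = a⇝c ++ˡ edge c∈S d∈S cd
  e⇝e : WalkLE VB e e 0
  e⇝e = stay e∈S
  d⇝e : WalkLE VB d e 1
  d⇝e = edge d∈S e∈S de
  c⇝e : WalkLE VB c e 2
  c⇝e = edge c∈S d∈S cd ++ˡ d⇝e
  b⇝e : WalkLE VB b e 3
  b⇝e = edge b∈S c∈S bc ++ˡ c⇝e

  -- Vertices at positions i < j are distinct: equality would shorten a–e.
  is-path : IsPath5 G VS a b c d e
  is-path = (a∈S , b∈S , c∈S , d∈S , e∈S) , (ab , bc , cd , de)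
    , far⇒≢ 0 far a⇝a b⇝e , far⇒≢ 1 far a⇝a c⇝e , far⇒≢ 2 far a⇝a d⇝e
    , far⇒≢ 3 far a⇝a e⇝e , far⇒≢ 0 far a⇝b c⇝e , far⇒≢ 1 far a⇝b d⇝e
    , far⇒≢ 2 far a⇝b e⇝e , far⇒≢ 0 far a⇝c d⇝e , far⇒≢ 1 far a⇝c e⇝e
    , far⇒≢ 0 far a⇝d e⇝e

  -- d_B(b,d) = 2: the walk b , c , d, and d_B(b,d) ≥ 4 − 1 − 1.
  dist-bd : Dist G VB b d 2
  dist-bd = step (S⊆B b∈S) bc (step (S⊆B c∈S) cd (here (S⊆B d∈S)))
          , far-inner 2 far a⇝b d⇝e

  to-nbr : ∀ {v x} → v ∈ VS → x ∈ cnbhd G v → WalkLE VB v x 1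
  to-nbr v∈S x∈ = cnbhd-walk (S⊆B v∈S) (cnbhd⊆closure closure v∈S x∈) x∈

  from-nbr : ∀ {v x} → v ∈ VS → x ∈ cnbhd G v → WalkLE VB x v 1
  from-nbr v∈S x∈ = cnbhd-walk (cnbhd⊆closure closure v∈S x∈) (S⊆B v∈S) (cnbhd-sym x∈)

  -- N[a], N[e] and N[b] ∩ N[d] are pairwise disjoint: a common vertex x
  -- would give an a–e walk of length ≤ 3 through x.
  Nbd : Subset n
  Nbd = cnbhd G b ∩ cnbhd G d

  disjoint-a-e : Disjoint (cnbhd G a) (cnbhd G e)
  disjoint-a-e x∈Na x∈Ne = far⇒≢ 1 far (to-nbr a∈S x∈Na) (from-nbr e∈S x∈Ne) refl

  disjoint-a-bd : Disjoint (cnbhd G a) Nbd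
  disjoint-a-bd x∈Na x∈Nbd =
    far⇒≢ 0 far (to-nbr a∈S x∈Na) (from-nbr d∈S (proj₂ (x∈p∩q⁻ _ _ x∈Nbd)) ++ˡ d⇝e) refl

  disjoint-e-bd : Disjoint (cnbhd G e) Nbd
  disjoint-e-bd x∈Ne x∈Nbd =
    far⇒≢ 0 far (a⇝b ++ˡ to-nbr b∈S (proj₁ (x∈p∩q⁻ _ _ x∈Nbd))) (from-nbr e∈S x∈Ne) refl

  disjoint-a-e∪bd : Disjoint (cnbhd G a) (cnbhd G e ∪ Nbd)
  disjoint-a-e∪bd x∈Na x∈ with x∈p∪q⁻ (cnbhd G e) Nbd x∈
  ... | inj₁ x∈Ne  = disjoint-a-e x∈Na x∈Ne
  ... | inj₂ x∈Nbd = disjoint-a-bd x∈Na x∈Nbd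

  ∣N[a]∪N[e]∪Nbd∣ : ∣ cnbhd G a ∪ cnbhd G e ∪ Nbd ∣ ≡ ∣ cnbhd G a ∣ + (∣ cnbhd G e ∣ + ∣ Nbd ∣)
  ∣N[a]∪N[e]∪Nbd∣ =
    trans (∣p∪q∣-disjoint (cnbhd G a) (cnbhd G e ∪ Nbd) disjoint-a-e∪bd)
          (cong (∣ cnbhd G a ∣ +_) (∣p∪q∣-disjoint (cnbhd G e) Nbd disjoint-e-bd))

  module Counting {δ : ℕ} (δ≤deg : ∀ v → δ ≤ degree G v) where

    NbB NdB : Subset n
    NbB = cnbhdIn G VB b
    NdB = cnbhdIn G VB d

    ∣cnbhdIn∣-lower : ∀ {v} → v ∈ VS → δ + 1 ≤ ∣ cnbhdIn G VB v ∣
    ∣cnbhdIn∣-lower {v} v∈S = ≤-trans (cnbhd-lower v (δ≤deg v))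
      (p⊆q⇒∣p∣≤∣q∣ λ x∈ → x∈p∩q⁺ (x∈ , cnbhd⊆closure closure v∈S x∈))

    union+inter-lower : 2 * (δ + 1) ≤ ∣ NbB ∪ NdB ∣ + ∣ NbB ∩ NdB ∣
    union+inter-lower = begin
      2 * (δ + 1)                  ≡⟨ cong ((δ + 1) +_) (+-identityʳ (δ + 1)) ⟩
      (δ + 1) + (δ + 1)            ≤⟨ +-mono-≤ (∣cnbhdIn∣-lower b∈S) (∣cnbhdIn∣-lower d∈S) ⟩
      ∣ NbB ∣ + ∣ NdB ∣             ≡⟨ ≡-sym (∣p∪q∣+∣p∩q∣≡∣p∣+∣q∣ NbB NdB) ⟩
      ∣ NbB ∪ NdB ∣ + ∣ NbB ∩ NdB ∣ ∎
      where open ≤-Reasoning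

    three-part-lower : 2 * (δ + 1) + ∣ NbB ∩ NdB ∣ ≤ ∣ cnbhd G a ∪ cnbhd G e ∪ Nbd ∣
    three-part-lower = begin
      2 * (δ + 1) + ∣ NbB ∩ NdB ∣             ≡⟨ regroup (δ + 1) ∣ NbB ∩ NdB ∣ ⟩
      (δ + 1) + ((δ + 1) + ∣ NbB ∩ NdB ∣)     ≤⟨ +-mono-≤ (cnbhd-lower a (δ≤deg a))
                                                  (+-mono-≤ (cnbhd-lower e (δ≤deg e)) inter≤Nbd) ⟩
      ∣ cnbhd G a ∣ + (∣ cnbhd G e ∣ + ∣ Nbd ∣) ≡⟨ ≡-sym ∣N[a]∪N[e]∪Nbd∣ ⟩
      ∣ cnbhd G a ∪ cnbhd G e ∪ Nbd ∣         ∎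
      where
      open ≤-Reasoning
      regroup : ∀ D I → 2 * D + I ≡ D + (D + I)
      regroup = solve-∀
      inter≤Nbd : ∣ NbB ∩ NdB ∣ ≤ ∣ Nbd ∣
      inter≤Nbd = p⊆q⇒∣p∣≤∣q∣ λ x∈ →
        let (x∈NbB , x∈NdB) = x∈p∩q⁻ NbB NdB x∈
        in x∈p∩q⁺ (proj₁ (x∈p∩q⁻ _ VB x∈NbB) , proj₁ (x∈p∩q⁻ _ VB x∈NdB))

    alternatives : Conclusion G δ VS VB a e
    alternatives with 28 * (δ + 1) ≤? 15 * ∣ NbB ∪ NdB ∣
    ... | yes large = inj₁ (b , d , b∈S , d∈S , dist-bd , large)
    ... | no small  = inj₂ (b , c , d , is-path ,
      counting-bound (δ + 1) _ _ _ (≰⇒> small) union+inter-lower three-part-lower)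

lemma7 : ∀ {n : ℕ} (G : Graph n) (δ : ℕ) (VS VB : Subset n) (a e : Fin n)
    → IsMinDegree G δ
    → IsClosedNbhdOf G VB VS
    → (∃[ u ] ∃[ v ] (u ∈ VS × v ∈ VS × DistGE G VB u v 4))
    → a ∈ VS → e ∈ VS
    → Dist G VB a e 4 → Dist G VS a e 4
    → (∃[ u ] ∃[ v ] (u ∈ VS × v ∈ VS × Dist G VB u v 2
         × 28 * (δ + 1) ≤ 15 * ∣ cnbhdIn G VB u ∪ cnbhdIn G VB v ∣))
      ⊎ (∃[ b ] ∃[ c ] ∃[ d ] (IsPath5 G VS a b c d e
         × 32 * (δ + 1)
             ≤ 15 * ∣ cnbhd G a ∪ cnbhd G e ∪ (cnbhd G b ∩ cnbhd G d) ∣))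
lemma7 G δ VS VB a e (δ≤deg , _) closure _ a∈S e∈S (_ , far)
       (step _ ab (step b∈S bc (step c∈S cd (step d∈S de (here _)))) , _) =
  Counting.alternatives δ≤deg
  where open Geodesic G closure a∈S b∈S c∈S d∈S e∈S ab bc cd de far
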